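{- With \[ r=\frac{1+x-x^{2}-\sqrt{x^{4}-2x^{3}-x^{2}-2x+1}}{2x},\qquad s=\frac{1+x-x^{2}+\sqrt{x^{4}-2x^{3}-x^{2}-2x+1}}{2x}, \] we have \[ \sum_P\mathrm{first}(P)\,x^{\mathrm{sper}(P)}=\frac{xs}{r(s-1)^2}=\frac{1-2x+x^2-2x^3+x^4-(1-x+x^2)\sqrt{1-2x-x^2-2x^3+x^4}}{2x^2}, \] the sum running over all Stanley polyominoes $P$. The coefficients of this series are (up to an index shift) the self-convolution of the RNA secondary structure numbers, i.e. of the sequence with generating function $R(x)=\frac{1-x+x^2-\sqrt{1-2x-x^2-2x^3+x^4}}{2x^2}$.
   Context: Cells are unit squares $[i,i+1]\times[j,j+1]$ with $i,j\in\mathbb{Z}$. A Stanley polyomino (up to translation) is a set of cells forming $k\geq 1$ rows $0,\dots,k-1$ (bottom to top), row $j$ consisting of the cells with $s_j\le i\le e_j$ ($s_j\le e_j$ integers), such that $s_{j-1}<s_j\le e_{j-1}<e_j$ for $1\le j\le k-1$. The semiperimeter is $\mathrm{sper}(P)=\mathrm{col}(P)+\mathrm{row}(P)$ where $\mathrm{col}(P)=e_{k-1}-s_0+1$ and $\mathrm{row}(P)=k$; $\mathrm{first}(P)=e_0-s_0+1$ is the number of cells in the first (bottom) row. -}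

module Defs where

open import Data.Nat as ℕ using (ℕ; zero; suc; _∸_; _≡ᵇ_; _≤ᵇ_; _<ᵇ_)
open import Data.Integer as ℤ using (ℤ; +_; -_)
open import Data.Bool using (Bool; true; false; _∧_)
open import Data.Product using (_×_; _,_)
open import Data.List using (List; []; _∷_; [_]; map; concatMap; upTo; filter; length; cartesianProduct; foldr)
open import Data.Nat.ListAction using (sum)
open import Relation.Binary.PropositionalEquality using (_≡_)
open import Relation.Nullary.Decidable using (T?)

-- Stanley polyominoes, normalised up to translation by s₀ = 0.
-- A polyomino is encoded as the list of its rows (sⱼ , eⱼ), bottom to top.

Row : Set
Row = ℕ × ℕ

-- the Stanley conditions  s_{j-1} < s_j ≤ e_{j-1} < e_j  (which imply s_j ≤ e_j)
chain : Row → List Row → Bool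
chain _ [] = true
chain (s , e) ((s' , e') ∷ rs) = (s <ᵇ s') ∧ (s' ≤ᵇ e) ∧ (e <ᵇ e') ∧ chain (s' , e') rs

isStanley : List Row → Bool
isStanley [] = false
isStanley ((s , e) ∷ rs) = (s ≡ᵇ 0) ∧ (s ≤ᵇ e) ∧ chain (s , e) rs

lastEnd : Row → List Row → ℕ
lastEnd (_ , e) [] = e
lastEnd _ (r ∷ rs) = lastEnd r rs

col : List Row → ℕ
col [] = 0
col ((s , e) ∷ rs) = suc (lastEnd (s , e) rs) ∸ s

row : List Row → ℕ
row = length

sper : List Row → ℕ
sper P = col P ℕ.+ row P

first : List Row → ℕ
first [] = 0
first ((s , e) ∷ _) = suc e ∸ s

allLists : {A : Set} → ℕ → List A → List (List A)
allLists zero xs = [ [] ]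
allLists (suc k) xs = concatMap (λ x → map (x ∷_) (allLists k xs)) xs

-- Every normalised Stanley polyomino of semiperimeter n has at most n rows
-- and all coordinates in [0, n]; so this (duplicate-free) list contains
-- every normalised Stanley polyomino with sper = n.
candidates : ℕ → List (List Row)
candidates n = concatMap (λ k → allLists k (cartesianProduct (upTo (suc n)) (upTo (suc n)))) (upTo (suc n))

stanleyOfSper : ℕ → List (List Row)
stanleyOfSper n = filter (λ P → T? (isStanley P ∧ (sper P ≡ᵇ n))) (candidates n)

firstCoeff : ℕ → ℤ
firstCoeff n = + sum (map first (stanleyOfSper n))

Series : Set
Series = ℕ → ℤ

conv : Series → Series → Series
conv f g n = foldr ℤ._+_ (+ 0) (map (λ i → f i ℤ.* g (n ∸ i)) (upTo (suc n)))

-- polynomial from its coefficient list (constant term first)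
poly : List ℤ → Series
poly [] _ = + 0
poly (c ∷ cs) zero = c
poly (c ∷ cs) (suc n) = poly cs n

_⊖s_ : Series → Series → Series
(f ⊖s g) n = f n ℤ.- g n

shift2 : Series → Series
shift2 f zero = + 0
shift2 f (suc zero) = + 0
shift2 f (suc (suc n)) = f n

Dpoly : Series
Dpoly = poly (+ 1 ∷ - + 2 ∷ - + 1 ∷ - + 2 ∷ + 1 ∷ [])

numPoly : Series
numPoly = poly (+ 1 ∷ - + 2 ∷ + 1 ∷ - + 2 ∷ + 1 ∷ [])

qPoly : Series
qPoly = poly (+ 1 ∷ - + 1 ∷ + 1 ∷ [])

-- √D as a formal power series: S² = D and S₀ = 1 (this determines S uniquely)
IsSqrtD : Series → Set
IsSqrtD S = (∀ n → conv S S n ≡ Dpoly n) × (S 0 ≡ + 1)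

module Submission where

-- Removing the bottom row (0 , e) of a Stanley polyomino leaves a chain of rows stacked on it.
-- The number tails m v of chains stacked on a row (s , s + v) with excess m (growth of the right
-- end plus number of rows) satisfies
--   tails m (v + 1) = tails m v + Σ_b tails (m − 2 − b) (v + 1 + b),
-- which is the recursion of the coefficients of ρ^v for ρ = 1 + x (R − 1), once R = 1 + x ρ R.
-- Weighting by first(P) = e + 1, the polyominoes with sper = n + 2 contribute the coefficient of
-- x^n in Σ_e (e + 1) x^e ρ^e = (1 − x ρ)⁻² = R². On the other side, S = q − 2 x² R with
-- q = 1 − x + x² squares to D exactly when x² R² − q R + 1 = 0, which is R = 1 + x ρ R,
-- and then 1 − 2x + x² − 2x³ + x⁴ − q S = 2 x⁴ R².

open import Defs
open import Level using (0ℓ)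
open import Algebra.Bundles using (CommutativeSemiring; CommutativeRing)
open import Data.Bool using (Bool; true; false; _∧_; if_then_else_; T)
open import Data.Empty using (⊥-elim)
open import Data.Fin using (toℕ)
open import Data.Fin.Properties using (toℕ<n)
import Data.Integer.Properties as ℤP
open import Data.List using (List; []; _∷_; map; foldr; _++_; filter; length; cartesianProduct; concatMap; upTo; applyUpTo)
open import Data.List.Properties using (map-++; map-∘; map-cong)
open import Data.Nat as ℕ using (ℕ; zero; suc; pred; _∸_; _≤_; _<_; z≤n; s≤s; s≤s⁻¹; _≡ᵇ_; _<ᵇ_; _≤ᵇ_)
import Data.Nat.Properties as ℕP
open import Data.Nat.ListAction using (sum)
open import Data.Nat.ListAction.Properties using (sum-++)
open import Data.Product using (_×_; _,_; proj₁; proj₂)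
open import Function using (_∘_)
open import Relation.Binary.PropositionalEquality
open import Relation.Nullary.Decidable using (T?; dec-true; dec-false)

module FiniteSum {c ℓ} (S : CommutativeSemiring c ℓ) where

  open CommutativeSemiring S hiding (setoid) renaming (refl to ≈-refl; sym to ≈-sym; trans to ≈-trans)
  open import Algebra.Properties.Semiring.Sum semiring
    using (sum-cong-≋; sum-replicate-zero; ∑-distrib-+; ∑-comm; *-distribˡ-sum) renaming (sum to sumᵥ)

  ∑< : ℕ → (ℕ → Carrier) → Carrier
  ∑< n f = sumᵥ {n} (f ∘ toℕ)

  ∑<-cong : ∀ n {f g} → (∀ i → i < n → f i ≈ g i) → ∑< n f ≈ ∑< n g
  ∑<-cong n f≈g = sum-cong-≋ (λ i → f≈g (toℕ i) (toℕ<n i))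

  ∑<-zero : ∀ n {f} → (∀ i → i < n → f i ≈ 0#) → ∑< n f ≈ 0#
  ∑<-zero n f≈0 = ≈-trans (∑<-cong n f≈0) (sum-replicate-zero n)

  ∑<-distrib-+ : ∀ n f g → ∑< n (λ i → f i + g i) ≈ ∑< n f + ∑< n g
  ∑<-distrib-+ n f g = ∑-distrib-+ {n} (f ∘ toℕ) (g ∘ toℕ)

  *-distribˡ-∑< : ∀ n x f → x * ∑< n f ≈ ∑< n (λ i → x * f i)
  *-distribˡ-∑< n x f = *-distribˡ-sum {n} x (f ∘ toℕ)

  ∑<-comm : ∀ m n (f : ℕ → ℕ → Carrier) → ∑< m (λ i → ∑< n (f i)) ≈ ∑< n (λ j → ∑< m (λ i → f i j))
  ∑<-comm m n f = ∑-comm {m} {n} (λ i j → f (toℕ i) (toℕ j))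

  ∑<-agree : ∀ m n {f g} → (∀ i → i < m → i < n → f i ≈ g i)
    → (∀ i → n ≤ i → i < m → f i ≈ 0#) → (∀ i → m ≤ i → i < n → g i ≈ 0#)
    → ∑< m f ≈ ∑< n g
  ∑<-agree zero n f≈g f≈0 g≈0 = ≈-sym (∑<-zero n (λ i → g≈0 i z≤n))
  ∑<-agree (suc m) zero f≈g f≈0 g≈0 = ∑<-zero (suc m) (λ i → f≈0 i z≤n)
  ∑<-agree (suc m) (suc n) f≈g f≈0 g≈0 =
    +-cong (f≈g 0 (s≤s z≤n) (s≤s z≤n))
      (∑<-agree m n (λ i p q → f≈g (suc i) (s≤s p) (s≤s q))
        (λ i p q → f≈0 (suc i) (s≤s p) (s≤s q)) (λ i p q → g≈0 (suc i) (s≤s p) (s≤s q)))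

  ∑<-truncate : ∀ m n {f} → m ≤ n → (∀ i → m ≤ i → i < n → f i ≈ 0#) → ∑< n f ≈ ∑< m f
  ∑<-truncate m n m≤n f≈0 =
    ∑<-agree n m (λ _ _ _ → ≈-refl) f≈0 (λ i n≤i i<m → ⊥-elim (ℕP.<⇒≱ (ℕP.<-≤-trans i<m m≤n) n≤i))

  ∑<-dropZeros : ∀ k n {f} → (∀ i → i < k → f i ≈ 0#) → ∑< n f ≈ ∑< (n ∸ k) (λ a → f (k ℕ.+ a))
  ∑<-dropZeros zero n f≈0 = ≈-refl
  ∑<-dropZeros (suc k) zero f≈0 = ≈-refl
  ∑<-dropZeros (suc k) (suc n) f≈0 =
    ≈-trans (+-cong (f≈0 0 (s≤s z≤n)) (∑<-dropZeros k n (λ i i<k → f≈0 (suc i) (s≤s i<k)))) (+-identityˡ _)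

  foldr-map-upTo : ∀ n f → foldr _+_ 0# (map f (upTo n)) ≈ ∑< n f
  foldr-map-upTo n f = go n (λ i → i)
    where
      go : ∀ n g → foldr _+_ 0# (map f (applyUpTo g n)) ≈ ∑< n (f ∘ g)
      go zero g = ≈-refl
      go (suc n) g = +-congˡ (go n (g ∘ suc))

module ℕΣ = FiniteSum ℕP.+-*-commutativeSemiring
module ℤΣ = FiniteSum ℤP.+-*-commutativeSemiring

module Counting where

  open import Data.Nat using (_+_; _*_)
  open ℕP
  open import Data.Nat.Tactic.RingSolver using (solve-∀)
  open ℕΣ using (∑<)

  sum-map-++ : ∀ {A : Set} (f : A → ℕ) xs ys → sum (map f (xs ++ ys)) ≡ sum (map f xs) + sum (map f ys)
  sum-map-++ f xs ys = trans (cong sum (map-++ f xs ys)) (sum-++ (map f xs) (map f ys))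

  module _ {A : Set} where

    sum-map-cong : ∀ {f g : A → ℕ} → (∀ x → f x ≡ g x) → ∀ xs → sum (map f xs) ≡ sum (map g xs)
    sum-map-cong f≗g xs = cong sum (map-cong f≗g xs)

    sum-map-zero : ∀ {f : A → ℕ} → (∀ x → f x ≡ 0) → ∀ xs → sum (map f xs) ≡ 0
    sum-map-zero f≗0 [] = refl
    sum-map-zero f≗0 (x ∷ xs) = cong₂ _+_ (f≗0 x) (sum-map-zero f≗0 xs)

    sum-map-if : ∀ b (f : A → ℕ) xs → sum (map (λ x → if b then f x else 0) xs) ≡ (if b then sum (map f xs) else 0)
    sum-map-if true f xs = refl
    sum-map-if false f xs = sum-map-zero (λ _ → refl) xs

    sum-map-filter : ∀ (p : A → Bool) (f : A → ℕ) xs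
      → sum (map f (filter (T? ∘ p) xs)) ≡ sum (map (λ x → if p x then f x else 0) xs)
    sum-map-filter p f [] = refl
    sum-map-filter p f (x ∷ xs) with p x
    ... | true = cong (f x +_) (sum-map-filter p f xs)
    ... | false = sum-map-filter p f xs

    *-distribˡ-sum-map : ∀ c (f : A → ℕ) xs → c * sum (map f xs) ≡ sum (map (λ x → c * f x) xs)
    *-distribˡ-sum-map c f [] = *-zeroʳ c
    *-distribˡ-sum-map c f (x ∷ xs) = trans (*-distribˡ-+ c (f x) _) (cong (c * f x +_) (*-distribˡ-sum-map c f xs))

    sum-map-concatMap : ∀ {B : Set} (f : B → ℕ) (g : A → List B) xs
      → sum (map f (concatMap g xs)) ≡ sum (map (λ x → sum (map f (g x))) xs)
    sum-map-concatMap f g [] = refl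
    sum-map-concatMap f g (x ∷ xs) = trans (sum-map-++ f (g x) (concatMap g xs)) (cong (sum (map f (g x)) +_) (sum-map-concatMap f g xs))

    sum-map-cartesianProduct : ∀ {B : Set} (f : A × B → ℕ) xs ys
      → sum (map f (cartesianProduct xs ys)) ≡ sum (map (λ x → sum (map (λ y → f (x , y)) ys)) xs)
    sum-map-cartesianProduct f [] ys = refl
    sum-map-cartesianProduct f (x ∷ xs) ys =
      trans (sum-map-++ f (map (x ,_) ys) (cartesianProduct xs ys))
        (cong₂ _+_ (cong sum (sym (map-∘ ys))) (sum-map-cartesianProduct f xs ys))

    sum-allLists-suc : ∀ (f : List A → ℕ) k xs
      → sum (map f (allLists (suc k) xs)) ≡ sum (map (λ x → sum (map (f ∘ (x ∷_)) (allLists k xs))) xs)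
    sum-allLists-suc f k xs =
      trans (sum-map-concatMap f (λ x → map (x ∷_) (allLists k xs)) xs)
        (sum-map-cong (λ x → cong sum (sym (map-∘ (allLists k xs)))) xs)

    sum-allLists-cong : ∀ {f g : List A → ℕ} k xs → (∀ rs → length rs ≡ k → f rs ≡ g rs)
      → sum (map f (allLists k xs)) ≡ sum (map g (allLists k xs))
    sum-allLists-cong zero xs f≗g = cong (_+ 0) (f≗g [] refl)
    sum-allLists-cong {f} {g} (suc k) xs f≗g = begin
      sum (map f (allLists (suc k) xs))
        ≡⟨ sum-allLists-suc f k xs ⟩
      sum (map (λ x → sum (map (f ∘ (x ∷_)) (allLists k xs))) xs)
        ≡⟨ sum-map-cong (λ x → sum-allLists-cong k xs (λ rs len → f≗g (x ∷ rs) (cong suc len))) xs ⟩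
      sum (map (λ x → sum (map (g ∘ (x ∷_)) (allLists k xs))) xs)
        ≡⟨ sum-allLists-suc g k xs ⟨
      sum (map g (allLists (suc k) xs))
        ∎
      where open ≡-Reasoning

  grid : ℕ → List Row
  grid n = cartesianProduct (upTo (suc n)) (upTo (suc n))

  sum-grid : ∀ n (f : Row → ℕ) → sum (map f (grid n)) ≡ ∑< (suc n) (λ s → ∑< (suc n) (λ e → f (s , e)))
  sum-grid n f = begin
    sum (map f (grid n))
      ≡⟨ sum-map-cartesianProduct f (upTo (suc n)) (upTo (suc n)) ⟩
    sum (map (λ s → sum (map (λ e → f (s , e)) (upTo (suc n)))) (upTo (suc n)))
      ≡⟨ sum-map-cong (λ s → ℕΣ.foldr-map-upTo (suc n) (λ e → f (s , e))) (upTo (suc n)) ⟩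
    sum (map (λ s → ∑< (suc n) (λ e → f (s , e))) (upTo (suc n)))
      ≡⟨ ℕΣ.foldr-map-upTo (suc n) _ ⟩
    ∑< (suc n) (λ s → ∑< (suc n) (λ e → f (s , e)))
      ∎
    where open ≡-Reasoning

  indicator : Bool → ℕ
  indicator b = if b then 1 else 0

  chainsIn : ℕ → ℕ → Row → ℕ → ℕ
  chainsIn n k r t = sum (map (λ rs → indicator (chain r rs ∧ (k + lastEnd r rs ≡ᵇ t))) (allLists k (grid n)))

  δ : ℕ → ℕ
  δ zero = 1
  δ (suc _) = 0

  -- chains k v u counts the ways to stack k more rows on a row (s , s + v) so that the top row ends
  -- at s + v + u − k; the next row is (s + 1 + a , s + v + 1 + b) with a < v.
  chains : ℕ → ℕ → ℕ → ℕ
  chains zero v u = δ u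
  chains (suc k) v u = ∑< v (λ a → ∑< (pred u) (λ b → chains k (v ∸ suc a + suc b) (u ∸ suc (suc b))))

  tails : ℕ → ℕ → ℕ
  tails m v = ∑< (suc m) (λ k → chains k v m)

  chain⇒≤lastEnd : ∀ r rs → T (chain r rs) → proj₂ r ≤ lastEnd r rs
  chain⇒≤lastEnd r [] _ = ≤-refl
  chain⇒≤lastEnd (s , e) ((s' , e') ∷ rs) h with s <ᵇ s' | s' ≤ᵇ e | e <ᵇ e' in e<e'
  ... | true | true | true = ≤-trans (<⇒≤ (<ᵇ⇒< e e' (subst T (sym e<e') _))) (chain⇒≤lastEnd (s' , e') rs h)

  chainsIn-excess : ∀ n k s e t → t < k + e → chainsIn n k (s , e) t ≡ 0
  chainsIn-excess n k s e t t<k+e = sum-map-zero noMatch (allLists k (grid n))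
    where
      noMatch : ∀ rs → indicator (chain (s , e) rs ∧ (k + lastEnd (s , e) rs ≡ᵇ t)) ≡ 0
      noMatch rs with chain (s , e) rs in isChain
      ... | false = refl
      ... | true = cong indicator (dec-false (k + lastEnd (s , e) rs ≟ t) λ eq →
            <⇒≱ t<k+e (subst (k + e ≤_) eq (+-monoʳ-≤ k (chain⇒≤lastEnd (s , e) rs (subst T (sym isChain) _)))))

  follows : Row → Row → Bool
  follows (s , e) (s' , e') = (s <ᵇ s') ∧ (s' ≤ᵇ e) ∧ (e <ᵇ e')

  chainsIn-suc : ∀ n k s e t → chainsIn n (suc k) (s , e) (suc t)
    ≡ ∑< (suc n) (λ s' → ∑< (suc n) (λ e' → if follows (s , e) (s' , e') then chainsIn n k (s' , e') t else 0))
  chainsIn-suc n k s e t = begin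
    chainsIn n (suc k) (s , e) (suc t)
      ≡⟨ sum-allLists-suc _ k (grid n) ⟩
    sum (map (λ r → sum (map (λ rs → indicator (chain (s , e) (r ∷ rs) ∧ (k + lastEnd r rs ≡ᵇ t))) L)) (grid n))
      ≡⟨ sum-map-cong (λ { r@(s' , e') → trans (sum-map-cong (λ rs → split (s <ᵇ s') (s' ≤ᵇ e) (e <ᵇ e') (chain r rs) _) L)
                                                   (sum-map-if (follows (s , e) r) _ L) }) (grid n) ⟩
    sum (map (λ r → if follows (s , e) r then chainsIn n k r t else 0) (grid n))
      ≡⟨ sum-grid n (λ r → if follows (s , e) r then chainsIn n k r t else 0) ⟩
    ∑< (suc n) (λ s' → ∑< (suc n) (λ e' → if follows (s , e) (s' , e') then chainsIn n k (s' , e') t else 0))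
      ∎
    where
      open ≡-Reasoning
      L = allLists k (grid n)
      split : ∀ a b c d z → indicator ((a ∧ b ∧ c ∧ d) ∧ z) ≡ (if a ∧ b ∧ c then indicator (d ∧ z) else 0)
      split false _ _ _ _ = refl
      split true false _ _ _ = refl
      split true true false _ _ = refl
      split true true true _ _ = refl

  chains-small : ∀ k v u → u < k → chains k v u ≡ 0
  chains-small (suc k) v zero _ = ℕΣ.∑<-zero v (λ _ _ → refl)
  chains-small (suc k) v (suc u) (s≤s u<k) =
    ℕΣ.∑<-zero v (λ a _ → ℕΣ.∑<-zero u (λ b _ → chains-small k (v ∸ suc a + suc b) (u ∸ suc b) (≤-<-trans (m∸n≤m u (suc b)) u<k)))

  -- The bounds say that the lowest row and the final right end s + v + u − k lie in the grid.
  ChainsAgree : ℕ → ℕ → Set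
  ChainsAgree n k = ∀ s v u → s + v ≤ n → s + v + u ≤ n + k → chainsIn n k (s , s + v) (s + v + u) ≡ chains k v u

  chainsAgree-zero : ∀ n → ChainsAgree n 0
  chainsAgree-zero n s v zero _ _ =
    cong (λ b → indicator b + 0) (dec-true (s + v ≟ s + v + 0) (sym (+-identityʳ (s + v))))
  chainsAgree-zero n s v (suc u) _ _ =
    cong (λ b → indicator b + 0) (dec-false (s + v ≟ s + v + suc u) λ eq → m≢1+m+n (s + v) (trans eq (+-suc (s + v) u)))

  nextEnds-sum : ∀ {n k} → ChainsAgree n k → ∀ s v u a → s + v ≤ n → s + v + u ≤ n + k → a < v
    → ∑< (suc n) (λ e' → if follows (s , s + v) (suc s + a , e') then chainsIn n k (suc s + a , e') (s + v + u) else 0)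
      ≡ ∑< u (λ b → chains k (v ∸ suc a + suc b) (u ∸ suc b))
  nextEnds-sum {n} {k} ih s v u a e≤n e+u≤n+k a<v = begin
    ∑< (suc n) (λ e' → if follows (s , e) (s' , e') then next e' else 0)
      ≡⟨ ℕΣ.∑<-cong (suc n) (λ e' _ → cong₂ (λ x y → if x ∧ y ∧ (e <ᵇ e') then next e' else 0)
           (dec-true (s <? s') (s≤s (m≤m+n s a))) (dec-true (s' ≤? e) (+-monoʳ-< s a<v))) ⟩
    ∑< (suc n) (λ e' → if e <ᵇ e' then next e' else 0)
      ≡⟨ ℕΣ.∑<-dropZeros (suc e) (suc n) (λ e' e'≤e → cong (λ x → if x then next e' else 0) (dec-false (e <? e') (≤⇒≯ (s≤s⁻¹ e'≤e)))) ⟩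
    ∑< (n ∸ e) (λ b → if e <ᵇ suc e + b then next (suc e + b) else 0)
      ≡⟨ ℕΣ.∑<-cong (n ∸ e) (λ b _ → cong (λ x → if x then next (suc e + b) else 0) (dec-true (e <? suc e + b) (s≤s (m≤m+n e b)))) ⟩
    ∑< (n ∸ e) (λ b → next (suc e + b))
      ≡⟨ ℕΣ.∑<-agree (n ∸ e) u shorter
           (λ b u≤b _ → chainsIn-excess n k s' (suc e + b) (e + u) (≤-trans (s≤s (+-monoʳ-≤ e u≤b)) (m≤n+m (suc e + b) k)))
           (λ b n∸e≤b b<u → chains-small k (v ∸ suc a + suc b) (u ∸ suc b) (noRoom b n∸e≤b b<u)) ⟩
    ∑< u (λ b → chains k (v ∸ suc a + suc b) (u ∸ suc b))
      ∎
    where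
      open ≡-Reasoning
      e = s + v
      s' = suc s + a
      next : ℕ → ℕ
      next e' = chainsIn n k (s' , e') (e + u)
      shorter : ∀ b → b < n ∸ e → b < u → next (suc e + b) ≡ chains k (v ∸ suc a + suc b) (u ∸ suc b)
      shorter b b<n∸e b<u = begin
        chainsIn n k (s' , suc e + b) (e + u)
          ≡⟨ cong₂ (λ x y → chainsIn n k (s' , x) y) end≡ budget≡ ⟩
        chainsIn n k (s' , s' + v') (s' + v' + (u ∸ suc b))
          ≡⟨ ih s' v' (u ∸ suc b) (subst (_≤ n) end≡ end≤n) (subst (_≤ n + k) budget≡ e+u≤n+k) ⟩
        chains k v' (u ∸ suc b)
          ∎
        where
          v' = v ∸ suc a + suc b
          end≡ : suc e + b ≡ s' + v'
          end≡ = trans (cong (λ w → suc (s + w + b)) (sym (m+[n∸m]≡n a<v))) (regroup s a (v ∸ suc a) b)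
            where
              regroup : ∀ s a d b → suc (s + (suc a + d) + b) ≡ suc (s + a) + (d + suc b)
              regroup = solve-∀
          budget≡ : e + u ≡ s' + v' + (u ∸ suc b)
          budget≡ = trans (cong (e +_) (sym (m+[n∸m]≡n b<u))) (trans (regroup e b (u ∸ suc b)) (cong (_+ (u ∸ suc b)) end≡))
            where
              regroup : ∀ e b d → e + (suc b + d) ≡ suc e + b + d
              regroup = solve-∀
          end≤n : suc e + b ≤ n
          end≤n = subst (_≤ n) (+-suc e b) (≤-trans (+-monoʳ-≤ e b<n∸e) (≤-reflexive (m+[n∸m]≡n e≤n)))
      noRoom : ∀ b → n ∸ e ≤ b → b < u → u ∸ suc b < k
      noRoom b n∸e≤b b<u = +-cancelˡ-≤ b _ _ (subst (_≤ b + k) (sym (trans (+-suc b (u ∸ suc b)) (m+[n∸m]≡n b<u))) u≤b+k)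
        where
          u≤b+k : u ≤ b + k
          u≤b+k = +-cancelˡ-≤ e _ _ (≤-trans e+u≤n+k
                    (≤-trans (+-monoˡ-≤ k (≤-trans (m≤n+m∸n n e) (+-monoʳ-≤ e n∸e≤b))) (≤-reflexive (+-assoc e b k))))

  chainsAgree-suc : ∀ {n k} → ChainsAgree n k → ChainsAgree n (suc k)
  chainsAgree-suc {n} {k} _ s v zero _ _ =
    trans (chainsIn-excess n (suc k) s (s + v) (s + v + 0) (s≤s (≤-trans (≤-reflexive (+-identityʳ (s + v))) (m≤n+m (s + v) k))))
          (sym (ℕΣ.∑<-zero v (λ _ _ → refl)))
  chainsAgree-suc {n} {k} ih s v (suc u) e≤n e+1+u≤n+1+k = begin
    chainsIn n (suc k) (s , e) (e + suc u)
      ≡⟨ cong (chainsIn n (suc k) (s , e)) (+-suc e u) ⟩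
    chainsIn n (suc k) (s , e) (suc (e + u))
      ≡⟨ chainsIn-suc n k s e (e + u) ⟩
    ∑< (suc n) (λ s' → ∑< (suc n) (next s'))
      ≡⟨ ℕΣ.∑<-dropZeros (suc s) (suc n) (λ s' s'≤s → ℕΣ.∑<-zero (suc n) (λ e' _ →
           cong (λ x → if x ∧ (s' ≤ᵇ e) ∧ (e <ᵇ e') then chainsIn n k (s' , e') (e + u) else 0) (dec-false (s <? s') (≤⇒≯ (s≤s⁻¹ s'≤s))))) ⟩
    ∑< (n ∸ s) (λ a → ∑< (suc n) (next (suc s + a)))
      ≡⟨ ℕΣ.∑<-agree (n ∸ s) v (λ a _ a<v → nextEnds-sum ih s v u a e≤n e+u≤n+k a<v)
           (λ a v≤a _ → ℕΣ.∑<-zero (suc n) (λ e' _ →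
              cong₂ (λ x y → if x ∧ y ∧ (e <ᵇ e') then chainsIn n k (suc s + a , e') (e + u) else 0)
                    (dec-true (s <? suc s + a) (s≤s (m≤m+n s a))) (dec-false (suc s + a ≤? e) (<⇒≱ (s≤s (+-monoʳ-≤ s v≤a))))))
           (λ a n∸s≤a a<v → ⊥-elim (<⇒≱ (<-≤-trans (+-monoʳ-< s a<v) e≤n) (≤-trans (m≤n+m∸n n s) (+-monoʳ-≤ s n∸s≤a)))) ⟩
    ∑< v (λ a → ∑< u (λ b → chains k (v ∸ suc a + suc b) (u ∸ suc b)))
      ∎
    where
      open ≡-Reasoning
      e = s + v
      next : ℕ → ℕ → ℕ
      next s' e' = if follows (s , e) (s' , e') then chainsIn n k (s' , e') (e + u) else 0
      e+u≤n+k : e + u ≤ n + k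
      e+u≤n+k = +-cancelˡ-≤ 1 _ _ (subst₂ _≤_ (+-suc e u) (+-suc n k) e+1+u≤n+1+k)

  chainsIn≡chains : ∀ n k → ChainsAgree n k
  chainsIn≡chains n zero = chainsAgree-zero n
  chainsIn≡chains n (suc k) = chainsAgree-suc (chainsIn≡chains n k)

  m∸[2+b]<m : ∀ m b → b < pred m → m ∸ suc (suc b) < m
  m∸[2+b]<m (suc m) b b<m = ∸-monoʳ-< {suc m} {suc (suc b)} {0} (s≤s z≤n) (s≤s b<m)

  tails-zero : ∀ m → tails m 0 ≡ δ m
  tails-zero m = trans (cong (δ m +_) (ℕΣ.∑<-zero m (λ _ _ → refl))) (+-identityʳ (δ m))

  tails-suc : ∀ m v → tails m (suc v) ≡ tails m v + ∑< (pred m) (λ b → tails (m ∸ suc (suc b)) (v + suc b))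
  tails-suc m v = begin
    δ m + ∑< m (λ k → new k + chains (suc k) v m)
      ≡⟨ cong (δ m +_) (ℕΣ.∑<-distrib-+ m new (λ k → chains (suc k) v m)) ⟩
    δ m + (∑< m new + ∑< m (λ k → chains (suc k) v m))
      ≡⟨ regroup (δ m) (∑< m new) _ ⟩
    tails m v + ∑< m new
      ≡⟨ cong (tails m v +_) (ℕΣ.∑<-comm m (pred m) (λ k b → chains k (v + suc b) (m ∸ suc (suc b)))) ⟩
    tails m v + ∑< (pred m) (λ b → ∑< m (λ k → chains k (v + suc b) (m ∸ suc (suc b))))
      ≡⟨ cong (tails m v +_) (ℕΣ.∑<-cong (pred m) (λ b b<m-1 → ℕΣ.∑<-truncate (suc (m ∸ suc (suc b))) m (m∸[2+b]<m m b b<m-1)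
           (λ k m-2-b<k _ → chains-small k (v + suc b) (m ∸ suc (suc b)) m-2-b<k))) ⟩
    tails m v + ∑< (pred m) (λ b → tails (m ∸ suc (suc b)) (v + suc b))
      ∎
    where
      open ≡-Reasoning
      new : ℕ → ℕ
      new k = ∑< (pred m) (λ b → chains k (v + suc b) (m ∸ suc (suc b)))
      regroup : ∀ x y z → x + (y + z) ≡ x + z + y
      regroup = solve-∀

  firstOfSper : ℕ → List Row → ℕ
  firstOfSper N P = if isStanley P ∧ (sper P ≡ᵇ N) then first P else 0

  if-then-else-* : ∀ b c → (if b then c else 0) ≡ c * indicator b
  if-then-else-* true c = sym (*-identityʳ c)
  if-then-else-* false c = sym (*-zeroʳ c)

  firstOfSper-bottomRow : ∀ n k e rs → length rs ≡ k
    → firstOfSper (suc (suc n)) ((0 , e) ∷ rs) ≡ suc e * indicator (chain (0 , e) rs ∧ (k + lastEnd (0 , e) rs ≡ᵇ n))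
  firstOfSper-bottomRow n k e rs len = trans
    (cong (λ z → if chain (0 , e) rs ∧ (z ≡ᵇ suc n) then suc e else 0)
          (trans (+-suc (lastEnd (0 , e) rs) (length rs)) (cong suc (trans (cong (lastEnd (0 , e) rs +_) len) (+-comm _ k)))))
    (if-then-else-* _ (suc e))

  sum-firstOfSper-rows : ∀ n k → sum (map (firstOfSper (suc (suc n))) (allLists (suc k) (grid (suc (suc n)))))
    ≡ ∑< (suc (suc (suc n))) (λ e → suc e * chainsIn (suc (suc n)) k (0 , e) n)
  sum-firstOfSper-rows n k = begin
    sum (map (firstOfSper N) (allLists (suc k) (grid N)))
      ≡⟨ sum-allLists-suc (firstOfSper N) k (grid N) ⟩
    sum (map (λ r → sum (map (firstOfSper N ∘ (r ∷_)) L)) (grid N))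
      ≡⟨ sum-grid N (λ r → sum (map (firstOfSper N ∘ (r ∷_)) L)) ⟩
    ∑< (suc N) (λ e → sum (map (firstOfSper N ∘ ((0 , e) ∷_)) L))
      + ∑< N (λ s → ∑< (suc N) (λ e → sum (map (firstOfSper N ∘ ((suc s , e) ∷_)) L)))
      ≡⟨ cong₂ _+_ (ℕΣ.∑<-cong (suc N) (λ e _ → bottomRow e))
                   (ℕΣ.∑<-zero N (λ s _ → ℕΣ.∑<-zero (suc N) (λ e _ → sum-map-zero (λ _ → refl) L))) ⟩
    ∑< (suc N) (λ e → suc e * chainsIn N k (0 , e) n) + 0
      ≡⟨ +-identityʳ _ ⟩
    ∑< (suc N) (λ e → suc e * chainsIn N k (0 , e) n)
      ∎
    where
      open ≡-Reasoning
      N = suc (suc n)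
      L = allLists k (grid N)
      bottomRow : ∀ e → sum (map (firstOfSper N ∘ ((0 , e) ∷_)) L) ≡ suc e * chainsIn N k (0 , e) n
      bottomRow e = trans (sum-allLists-cong k (grid N) (firstOfSper-bottomRow n k e))
                          (sym (*-distribˡ-sum-map (suc e) _ L))

  sum-first-chainsIn : ∀ n → sum (map first (stanleyOfSper (suc (suc n))))
    ≡ ∑< (suc (suc n)) (λ k → ∑< (suc (suc (suc n))) (λ e → suc e * chainsIn (suc (suc n)) k (0 , e) n))
  sum-first-chainsIn n = begin
    sum (map first (stanleyOfSper N))
      ≡⟨ sum-map-filter (λ P → isStanley P ∧ (sper P ≡ᵇ N)) first (candidates N) ⟩
    sum (map (firstOfSper N) (candidates N))
      ≡⟨ sum-map-concatMap (firstOfSper N) (λ k → allLists k (grid N)) (upTo (suc N)) ⟩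
    sum (map (λ k → sum (map (firstOfSper N) (allLists k (grid N)))) (upTo (suc N)))
      ≡⟨ ℕΣ.foldr-map-upTo (suc N) (λ k → sum (map (firstOfSper N) (allLists k (grid N)))) ⟩
    ∑< N (λ k → sum (map (firstOfSper N) (allLists (suc k) (grid N))))
      ≡⟨ ℕΣ.∑<-cong N (λ k _ → sum-firstOfSper-rows n k) ⟩
    ∑< N (λ k → ∑< (suc N) (λ e → suc e * chainsIn N k (0 , e) n))
      ∎
    where
      open ≡-Reasoning
      N = suc (suc n)

  chainsIn-bottomRow : ∀ n k e → e ≤ n → chainsIn (suc (suc n)) k (0 , e) n ≡ chains k e (n ∸ e)
  chainsIn-bottomRow n k e e≤n = trans
    (cong (chainsIn (suc (suc n)) k (0 , e)) (sym (m+[n∸m]≡n e≤n)))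
    (chainsIn≡chains (suc (suc n)) k 0 e (n ∸ e) (≤-trans e≤n n≤2+n)
      (≤-trans (≤-reflexive (m+[n∸m]≡n e≤n)) (≤-trans n≤2+n (m≤m+n _ k))))
    where
      n≤2+n : n ≤ suc (suc n)
      n≤2+n = ≤-trans (n≤1+n n) (n≤1+n (suc n))

  sum-first-tails : ∀ n → sum (map first (stanleyOfSper (suc (suc n)))) ≡ ∑< (suc n) (λ e → suc e * tails (n ∸ e) e)
  sum-first-tails n = begin
    sum (map first (stanleyOfSper N))
      ≡⟨ sum-first-chainsIn n ⟩
    ∑< N (λ k → ∑< (suc N) (λ e → suc e * chainsIn N k (0 , e) n))
      ≡⟨ ℕΣ.∑<-cong N (λ k _ → ℕΣ.∑<-truncate (suc n) (suc N) (≤-trans (n≤1+n (suc n)) (n≤1+n N))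
           (λ e n<e _ → trans (cong (suc e *_) (chainsIn-excess N k 0 e n (<-≤-trans n<e (m≤n+m e k)))) (*-zeroʳ (suc e)))) ⟩
    ∑< N (λ k → ∑< (suc n) (λ e → suc e * chainsIn N k (0 , e) n))
      ≡⟨ ℕΣ.∑<-cong N (λ k _ → ℕΣ.∑<-cong (suc n) (λ e e<1+n → cong (suc e *_) (chainsIn-bottomRow n k e (s≤s⁻¹ e<1+n)))) ⟩
    ∑< N (λ k → ∑< (suc n) (λ e → suc e * chains k e (n ∸ e)))
      ≡⟨ ℕΣ.∑<-comm N (suc n) (λ k e → suc e * chains k e (n ∸ e)) ⟩
    ∑< (suc n) (λ e → ∑< N (λ k → suc e * chains k e (n ∸ e)))
      ≡⟨ ℕΣ.∑<-cong (suc n) (λ e _ → sym (ℕΣ.*-distribˡ-∑< N (suc e) (λ k → chains k e (n ∸ e)))) ⟩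
    ∑< (suc n) (λ e → suc e * ∑< N (λ k → chains k e (n ∸ e)))
      ≡⟨ ℕΣ.∑<-cong (suc n) (λ e _ → cong (suc e *_) (ℕΣ.∑<-truncate (suc (n ∸ e)) N (s≤s (≤-trans (m∸n≤m n e) (n≤1+n n)))
           (λ k n-e<k _ → chains-small k e (n ∸ e) n-e<k))) ⟩
    ∑< (suc n) (λ e → suc e * tails (n ∸ e) e)
      ∎
    where
      open ≡-Reasoning
      N = suc (suc n)

module PowerSeries where

  open import Data.Integer using (ℤ; +_; -_; _+_; _*_; _-_; NonZero; _≟_; +-*-rawRing)
  open import Data.Integer.Tactic.RingSolver using (solve-∀)
  open import Data.Maybe using (Maybe; just; nothing)
  open import Data.Nat.Induction using (<-rec)
  open import Relation.Nullary using (yes; no)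
  open import Algebra.Properties.AbelianGroup ℤP.+-0-abelianGroup using () renaming (∙-cancelˡ to +-cancelˡ)
  open import Algebra.Solver.Ring.AlmostCommutativeRing using (fromCommutativeRing; _-Raw-AlmostCommutative⟶_)
  import Algebra.Construct.Pointwise as Pointwise
  import Algebra.Definitions.RawSemiring
  import Algebra.Solver.Ring
  import Relation.Binary.Reasoning.Setoid
  open Counting using (tails; tails-zero; tails-suc; sum-first-tails; δ; m∸[2+b]<m)
  open ℤΣ using (∑<)

  infix 4 _≈ₛ_
  infixl 6 _+ₛ_ _-ₛ_
  infixl 7 _*ₛ_
  infixr 7 _·ₛ_

  _≈ₛ_ : Series → Series → Set
  f ≈ₛ g = ∀ n → f n ≡ g n

  _+ₛ_ : Series → Series → Series
  (f +ₛ g) n = f n + g n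

  -ₛ_ : Series → Series
  (-ₛ f) n = - f n

  _-ₛ_ : Series → Series → Series
  f -ₛ g = f +ₛ -ₛ g

  0ₛ : Series
  0ₛ _ = + 0

  ι : ℤ → Series
  ι c = poly (c ∷ [])

  _·ₛ_ : ℤ → Series → Series
  (c ·ₛ f) n = c * f n

  X : Series
  X = poly (+ 0 ∷ + 1 ∷ [])

  conv-∑< : ∀ f g n → conv f g n ≡ ∑< (suc n) (λ i → f i * g (n ∸ i))
  conv-∑< f g n = ℤΣ.foldr-map-upTo (suc n) (λ i → f i * g (n ∸ i))

  conv-suc : ∀ f g n → conv f g (suc n) ≡ f 0 * g (suc n) + conv (f ∘ suc) g n
  conv-suc f g n = trans (conv-∑< f g (suc n)) (cong (λ z → f 0 * g (suc n) + z) (sym (conv-∑< (f ∘ suc) g n)))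

  conv-zero : ∀ f g → conv f g 0 ≡ f 0 * g 0
  conv-zero f g = ℤP.+-identityʳ (f 0 * g 0)

  conv-cong : ∀ {f f' g g'} → f ≈ₛ f' → g ≈ₛ g' → conv f g ≈ₛ conv f' g'
  conv-cong {f} {f'} {g} {g'} f≈f' g≈g' n = begin
    conv f g n
      ≡⟨ conv-∑< f g n ⟩
    ∑< (suc n) (λ i → f i * g (n ∸ i))
      ≡⟨ ℤΣ.∑<-cong (suc n) (λ i _ → cong₂ _*_ (f≈f' i) (g≈g' (n ∸ i))) ⟩
    ∑< (suc n) (λ i → f' i * g' (n ∸ i))
      ≡⟨ conv-∑< f' g' n ⟨
    conv f' g' n
      ∎
    where open ≡-Reasoning

  conv-distribʳ : ∀ h f g → conv (f +ₛ g) h ≈ₛ conv f h +ₛ conv g h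
  conv-distribʳ h f g n = begin
    conv (f +ₛ g) h n
      ≡⟨ conv-∑< (f +ₛ g) h n ⟩
    ∑< (suc n) (λ i → (f i + g i) * h (n ∸ i))
      ≡⟨ ℤΣ.∑<-cong (suc n) (λ i _ → ℤP.*-distribʳ-+ (h (n ∸ i)) (f i) (g i)) ⟩
    ∑< (suc n) (λ i → f i * h (n ∸ i) + g i * h (n ∸ i))
      ≡⟨ ℤΣ.∑<-distrib-+ (suc n) (λ i → f i * h (n ∸ i)) (λ i → g i * h (n ∸ i)) ⟩
    ∑< (suc n) (λ i → f i * h (n ∸ i)) + ∑< (suc n) (λ i → g i * h (n ∸ i))
      ≡⟨ cong₂ _+_ (conv-∑< f h n) (conv-∑< g h n) ⟨
    conv f h n + conv g h n
      ∎
    where open ≡-Reasoning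

  conv-·ˡ : ∀ c f g → conv (c ·ₛ f) g ≈ₛ c ·ₛ conv f g
  conv-·ˡ c f g n = begin
    conv (c ·ₛ f) g n
      ≡⟨ conv-∑< (c ·ₛ f) g n ⟩
    ∑< (suc n) (λ i → c * f i * g (n ∸ i))
      ≡⟨ ℤΣ.∑<-cong (suc n) (λ i _ → ℤP.*-assoc c (f i) (g (n ∸ i))) ⟩
    ∑< (suc n) (λ i → c * (f i * g (n ∸ i)))
      ≡⟨ ℤΣ.*-distribˡ-∑< (suc n) c (λ i → f i * g (n ∸ i)) ⟨
    c * ∑< (suc n) (λ i → f i * g (n ∸ i))
      ≡⟨ cong (c *_) (conv-∑< f g n) ⟨
    c * conv f g n
      ∎
    where open ≡-Reasoning

  conv-ιˡ : ∀ c f n → conv (ι c) f n ≡ c * f n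
  conv-ιˡ c f zero = conv-zero (ι c) f
  conv-ιˡ c f (suc n) = begin
    conv (ι c) f (suc n)
      ≡⟨ conv-suc (ι c) f n ⟩
    c * f (suc n) + conv (λ _ → + 0) f n
      ≡⟨ cong (λ z → c * f (suc n) + z) (trans (conv-∑< (λ _ → + 0) f n) (ℤΣ.∑<-zero (suc n) {λ i → + 0 * f (n ∸ i)} (λ _ _ → refl))) ⟩
    c * f (suc n) + + 0
      ≡⟨ ℤP.+-identityʳ _ ⟩
    c * f (suc n)
      ∎
    where open ≡-Reasoning

  conv-comm : ∀ f g → conv f g ≈ₛ conv g f
  conv-comm f g zero = cong (_+ + 0) (ℤP.*-comm (f 0) (g 0))
  conv-comm f g (suc zero) = swap (f 0) (g 1) (f 1) (g 0)
    where
      swap : ∀ a b c d → a * b + (c * d + + 0) ≡ d * c + (b * a + + 0)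
      swap = solve-∀
  conv-comm f g (suc (suc n)) = begin
    conv f g (2 ℕ.+ n)                                         ≡⟨ conv-suc f g (suc n) ⟩
    a + conv (f ∘ suc) g (suc n)                               ≡⟨ cong (λ z → a + z) (conv-comm (f ∘ suc) g (suc n)) ⟩
    a + conv g (f ∘ suc) (suc n)                               ≡⟨ cong (λ z → a + z) (conv-suc g (f ∘ suc) n) ⟩
    a + (b + conv (g ∘ suc) (f ∘ suc) n)                       ≡⟨ cong (λ z → a + (b + z)) (conv-comm (g ∘ suc) (f ∘ suc) n) ⟩
    a + (b + conv (f ∘ suc) (g ∘ suc) n)                       ≡⟨ exchange a b _ ⟩
    b + (a + conv (f ∘ suc) (g ∘ suc) n)                       ≡⟨ cong (λ z → b + z) (conv-suc f (g ∘ suc) n) ⟨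
    b + conv f (g ∘ suc) (suc n)                               ≡⟨ cong (λ z → b + z) (conv-comm f (g ∘ suc) (suc n)) ⟩
    b + conv (g ∘ suc) f (suc n)                               ≡⟨ conv-suc g f (suc n) ⟨
    conv g f (2 ℕ.+ n)                                         ∎
    where
      open ≡-Reasoning
      a = f 0 * g (2 ℕ.+ n)
      b = g 0 * f (2 ℕ.+ n)
      exchange : ∀ a b c → a + (b + c) ≡ b + (a + c)
      exchange = solve-∀

  conv-assoc : ∀ f g h → conv (conv f g) h ≈ₛ conv f (conv g h)
  conv-assoc f g h zero = begin
    conv f g 0 * h 0 + + 0     ≡⟨ cong (λ z → z * h 0 + + 0) (conv-zero f g) ⟩
    f 0 * g 0 * h 0 + + 0      ≡⟨ cong (_+ + 0) (ℤP.*-assoc (f 0) (g 0) (h 0)) ⟩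
    f 0 * (g 0 * h 0) + + 0    ≡⟨ cong (λ z → f 0 * z + + 0) (conv-zero g h) ⟨
    f 0 * conv g h 0 + + 0     ∎
    where open ≡-Reasoning
  conv-assoc f g h (suc n) = begin
    conv (conv f g) h (suc n)                          ≡⟨ conv-suc (conv f g) h n ⟩
    conv f g 0 * h (suc n) + conv (conv f g ∘ suc) h n
      ≡⟨ cong₂ (λ a b → a * h (suc n) + b) (conv-zero f g) (conv-cong {g = h} (conv-suc f g) (λ _ → refl) n) ⟩
    f 0 * g 0 * h (suc n) + conv (f 0 ·ₛ (g ∘ suc) +ₛ conv (f ∘ suc) g) h n
      ≡⟨ cong (λ z → f 0 * g 0 * h (suc n) + z) (conv-distribʳ h (f 0 ·ₛ (g ∘ suc)) (conv (f ∘ suc) g) n) ⟩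
    f 0 * g 0 * h (suc n) + (conv (f 0 ·ₛ (g ∘ suc)) h n + conv (conv (f ∘ suc) g) h n)
      ≡⟨ cong₂ (λ a b → f 0 * g 0 * h (suc n) + (a + b)) (conv-·ˡ (f 0) (g ∘ suc) h n) (conv-assoc (f ∘ suc) g h n) ⟩
    f 0 * g 0 * h (suc n) + (f 0 * conv (g ∘ suc) h n + conv (f ∘ suc) (conv g h) n)
      ≡⟨ factor (f 0) (g 0) (h (suc n)) _ _ ⟩
    f 0 * (g 0 * h (suc n) + conv (g ∘ suc) h n) + conv (f ∘ suc) (conv g h) n
      ≡⟨ cong (λ z → f 0 * z + conv (f ∘ suc) (conv g h) n) (conv-suc g h n) ⟨
    f 0 * conv g h (suc n) + conv (f ∘ suc) (conv g h) n
      ≡⟨ conv-suc f (conv g h) n ⟨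
    conv f (conv g h) (suc n) ∎
    where
      open ≡-Reasoning
      factor : ∀ a b c d e → a * b * c + (a * d + e) ≡ a * (b * c + d) + e
      factor = solve-∀

  conv-identityˡ : ∀ f → conv (ι (+ 1)) f ≈ₛ f
  conv-identityˡ f n = trans (conv-ιˡ (+ 1) f n) (ℤP.*-identityˡ (f n))

  seriesRing : CommutativeRing 0ℓ 0ℓ
  seriesRing = record
    { Carrier = Series ; _≈_ = _≈ₛ_ ; _+_ = _+ₛ_ ; _*_ = conv ; -_ = -ₛ_ ; 0# = 0ₛ ; 1# = ι (+ 1)
    ; isCommutativeRing = record
      { isRing = record
        { +-isAbelianGroup = Pointwise.isAbelianGroup ℕ ℤP.+-0-isAbelianGroup
        ; *-cong = conv-cong
        ; *-assoc = conv-assoc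
        ; *-identity = conv-identityˡ , λ f n → trans (conv-comm f (ι (+ 1)) n) (conv-identityˡ f n)
        ; distrib = conv-distribˡ , conv-distribʳ
        }
      ; *-comm = conv-comm
      }
    }
    where
      conv-distribˡ : ∀ h f g → conv h (f +ₛ g) ≈ₛ conv h f +ₛ conv h g
      conv-distribˡ h f g n = trans (conv-comm h (f +ₛ g) n)
        (trans (conv-distribʳ h f g n) (cong₂ _+_ (conv-comm f h n) (conv-comm g h n)))

  module 𝕊 = CommutativeRing seriesRing
  module ≈ₛ-Reasoning = Relation.Binary.Reasoning.Setoid 𝕊.setoid
  open Algebra.Definitions.RawSemiring (CommutativeSemiring.rawSemiring 𝕊.commutativeSemiring) using (_^_)

  _*ₛ_ : Series → Series → Series
  _*ₛ_ = conv

  ι-homomorphism : +-*-rawRing -Raw-AlmostCommutative⟶ fromCommutativeRing seriesRing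
  ι-homomorphism = record
    { ⟦_⟧ = ι
    ; +-homo = λ { a b zero → refl ; a b (suc n) → refl }
    ; *-homo = λ { a b zero → sym (conv-ιˡ a (ι b) 0) ; a b (suc n) → sym (trans (conv-ιˡ a (ι b) (suc n)) (ℤP.*-zeroʳ a)) }
    ; -‿homo = λ { a zero → refl ; a (suc n) → refl }
    ; 0-homo = λ { zero → refl ; (suc n) → refl }
    ; 1-homo = λ _ → refl
    }

  ι-≟ : ∀ a b → Maybe (ι a ≈ₛ ι b)
  ι-≟ a b with a ≟ b
  ... | yes refl = just (λ _ → refl)
  ... | no _ = nothing

  -- Constants are taken from ℤ so that the solver can compute with them; with constant series as
  -- coefficients its final normal-form comparison would not reduce.
  module SeriesSolver = Algebra.Solver.Ring +-*-rawRing (fromCommutativeRing seriesRing) ι-homomorphism ι-≟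
  open SeriesSolver using (Polynomial; solve; _:=_; con; _:+_; _:*_; _:-_)

  *ₛ-congˡ : ∀ f {g g'} → g ≈ₛ g' → f *ₛ g ≈ₛ f *ₛ g'
  *ₛ-congˡ f {g} {g'} = conv-cong {f} {f} {g} {g'} (λ _ → refl)

  *ₛ-congʳ : ∀ {f f'} g → f ≈ₛ f' → f *ₛ g ≈ₛ f' *ₛ g
  *ₛ-congʳ {f} {f'} g f≈f' = conv-cong {f} {f'} {g} {g} f≈f' (λ _ → refl)

  *ₛ-zeroʳ : ∀ f {g} → g ≈ₛ 0ₛ → f *ₛ g ≈ₛ 0ₛ
  *ₛ-zeroʳ f g≈0 = 𝕊.trans (*ₛ-congˡ f g≈0) (𝕊.zeroʳ f)

  +ₛ-congˡ : ∀ f {g g'} → g ≈ₛ g' → f +ₛ g ≈ₛ f +ₛ g'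
  +ₛ-congˡ f g≈g' n = cong (λ z → f n + z) (g≈g' n)

  +ₛ-congʳ : ∀ {f f'} g → f ≈ₛ f' → f +ₛ g ≈ₛ f' +ₛ g
  +ₛ-congʳ g f≈f' n = cong (λ z → z + g n) (f≈f' n)

  -ₛ-cong : ∀ {f f' g g'} → f ≈ₛ f' → g ≈ₛ g' → f -ₛ g ≈ₛ f' -ₛ g'
  -ₛ-cong f≈f' g≈g' n = cong₂ _-_ (f≈f' n) (g≈g' n)

  -ₛ-zeroʳ : ∀ f {g} → g ≈ₛ 0ₛ → f -ₛ g ≈ₛ f
  -ₛ-zeroʳ f g≈0 n = trans (cong (λ z → f n - z) (g≈0 n)) (ℤP.+-identityʳ (f n))

  X*ₛ-suc : ∀ f n → (X *ₛ f) (suc n) ≡ f n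
  X*ₛ-suc f n = trans (conv-suc X f n) (trans (ℤP.+-identityˡ _) (conv-identityˡ f n))

  shift2≈X*X* : ∀ f → shift2 f ≈ₛ X *ₛ (X *ₛ f)
  shift2≈X*X* f zero = refl
  shift2≈X*X* f (suc zero) = refl
  shift2≈X*X* f (suc (suc n)) = sym (trans (X*ₛ-suc (X *ₛ f) (suc n)) (X*ₛ-suc f n))

  X-cancel : ∀ f → X *ₛ f ≈ₛ 0ₛ → f ≈ₛ 0ₛ
  X-cancel f Xf≈0 n = trans (sym (X*ₛ-suc f n)) (Xf≈0 (suc n))

  ι-cancel : ∀ c .{{_ : NonZero c}} f → ι c *ₛ f ≈ₛ 0ₛ → f ≈ₛ 0ₛ
  ι-cancel c f cf≈0 n = ℤP.*-cancelˡ-≡ c (f n) (+ 0) (trans (sym (conv-ιˡ c f n)) (trans (cf≈0 n) (sym (ℤP.*-zeroʳ c))))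

  X-recursion-unique : (F F' G : ℕ → Series)
    → (∀ j → F j ≈ₛ G j +ₛ X *ₛ F (suc j)) → (∀ j → F' j ≈ₛ G j +ₛ X *ₛ F' (suc j))
    → ∀ j → F j ≈ₛ F' j
  X-recursion-unique F F' G F-rec F'-rec j zero = trans (F-rec j 0) (sym (F'-rec j 0))
  X-recursion-unique F F' G F-rec F'-rec j (suc n) = begin
    F j (suc n)                                ≡⟨ F-rec j (suc n) ⟩
    G j (suc n) + (X *ₛ F (suc j)) (suc n)     ≡⟨ cong (λ z → G j (suc n) + z) (X*ₛ-suc (F (suc j)) n) ⟩
    G j (suc n) + F (suc j) n                  ≡⟨ cong (λ z → G j (suc n) + z) (X-recursion-unique F F' G F-rec F'-rec (suc j) n) ⟩
    G j (suc n) + F' (suc j) n                 ≡⟨ cong (λ z → G j (suc n) + z) (X*ₛ-suc (F' (suc j)) n) ⟨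
    G j (suc n) + (X *ₛ F' (suc j)) (suc n)    ≡⟨ F'-rec j (suc n) ⟨
    F' j (suc n)                               ∎
    where open ≡-Reasoning

  horner : Series → List ℤ → Series
  horner x [] = ι (+ 0)
  horner x (c ∷ cs) = ι c +ₛ x *ₛ horner x cs

  hornerₑ : ∀ {k} → Polynomial k → List ℤ → Polynomial k
  hornerₑ x [] = con (+ 0)
  hornerₑ x (c ∷ cs) = con c :+ x :* hornerₑ x cs

  poly≈horner : ∀ cs → poly cs ≈ₛ horner X cs
  poly≈horner [] zero = refl
  poly≈horner [] (suc n) = refl
  poly≈horner (c ∷ cs) zero = sym (ℤP.+-identityʳ c)
  poly≈horner (c ∷ cs) (suc n) = sym (trans (ℤP.+-identityˡ _) (trans (X*ₛ-suc (horner X cs) n) (sym (poly≈horner cs n))))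

  pos-∑< : ∀ n f → + ℕΣ.∑< n f ≡ ∑< n (+_ ∘ f)
  pos-∑< zero f = refl
  pos-∑< (suc n) f = trans (ℤP.pos-+ (f 0) _) (cong (λ z → + f 0 + z) (pos-∑< n (f ∘ suc)))

  ρ : Series → Series
  ρ R = ι (+ 1) +ₛ X *ₛ (R -ₛ ι (+ 1))

  module Tails (R : Series) (R-eq : R ≈ₛ ι (+ 1) +ₛ X *ₛ (ρ R *ₛ R)) where

    geometric-step : ∀ j → ρ R ^ j *ₛ R ≈ₛ ρ R ^ j +ₛ X *ₛ (ρ R ^ suc j *ₛ R)
    geometric-step j = 𝕊.trans (*ₛ-congˡ (ρ R ^ j) R-eq)
      (solve 4 (λ p r x y → p :* (con (+ 1) :+ x :* (r :* y)) := p :+ x :* (r :* p :* y)) (λ _ → refl) (ρ R ^ j) (ρ R) X R)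

    ρ-eq : ρ R ≈ₛ ι (+ 1) +ₛ X *ₛ (X *ₛ (ρ R *ₛ R))
    ρ-eq = begin
      ι (+ 1) +ₛ X *ₛ (R -ₛ ι (+ 1))
        ≈⟨ +ₛ-congˡ (ι (+ 1)) (*ₛ-congˡ X (-ₛ-cong {g = ι (+ 1)} R-eq (λ _ → refl))) ⟩
      ι (+ 1) +ₛ X *ₛ ((ι (+ 1) +ₛ X *ₛ (ρ R *ₛ R)) -ₛ ι (+ 1))
        ≈⟨ solve 3 (λ x r y → con (+ 1) :+ x :* ((con (+ 1) :+ x :* (r :* y)) :- con (+ 1))
                             := con (+ 1) :+ x :* (x :* (r :* y))) (λ _ → refl) X (ρ R) R ⟩
      ι (+ 1) +ₛ X *ₛ (X *ₛ (ρ R *ₛ R))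
        ∎
      where open ≈ₛ-Reasoning

    power-step : ∀ v → ρ R ^ suc v ≈ₛ ρ R ^ v +ₛ X *ₛ (X *ₛ (ρ R ^ suc v *ₛ R))
    power-step v = begin
      ρ R *ₛ ρ R ^ v
        ≈⟨ *ₛ-congʳ (ρ R ^ v) ρ-eq ⟩
      (ι (+ 1) +ₛ X *ₛ (X *ₛ (ρ R *ₛ R))) *ₛ ρ R ^ v
        ≈⟨ solve 4 (λ p x r y → (con (+ 1) :+ x :* (x :* (r :* y))) :* p := p :+ x :* (x :* (r :* p :* y))) (λ _ → refl) (ρ R ^ v) X (ρ R) R ⟩
      ρ R ^ v +ₛ X *ₛ (X *ₛ (ρ R ^ suc v *ₛ R))
        ∎
      where open ≈ₛ-Reasoning

    -- Coefficientwise, geometric j = Σ_b x^b ρ^(j+b) and weighted j = Σ_b (b + 1) x^b ρ^(j+b).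
    geometric : ℕ → Series
    geometric j n = ∑< (suc n) (λ b → (ρ R ^ (j ℕ.+ b)) (n ∸ b))

    geometric-rec : ∀ j → geometric j ≈ₛ ρ R ^ j +ₛ X *ₛ geometric (suc j)
    geometric-rec j zero = cong (λ i → (ρ R ^ i) 0 + + 0) (ℕP.+-identityʳ j)
    geometric-rec j (suc n) = trans
      (cong₂ _+_ (cong (λ i → (ρ R ^ i) (suc n)) (ℕP.+-identityʳ j))
                 (ℤΣ.∑<-cong (suc n) (λ b _ → cong (λ i → (ρ R ^ i) (n ∸ b)) (ℕP.+-suc j b))))
      (cong (λ z → (ρ R ^ j) (suc n) + z) (sym (X*ₛ-suc (geometric (suc j)) n)))

    geometric≈ : ∀ j → geometric j ≈ₛ ρ R ^ j *ₛ R
    geometric≈ = X-recursion-unique geometric (λ j → ρ R ^ j *ₛ R) (ρ R ^_) geometric-rec geometric-step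

    weighted : ℕ → Series
    weighted j n = ∑< (suc n) (λ b → + suc b * (ρ R ^ (j ℕ.+ b)) (n ∸ b))

    weighted-rec : ∀ j → weighted j ≈ₛ geometric j +ₛ X *ₛ weighted (suc j)
    weighted-rec j zero = cong (_+ + 0) (trans (ℤP.*-identityˡ ((ρ R ^ (j ℕ.+ 0)) 0)) (sym (ℤP.+-identityʳ _)))
    weighted-rec j (suc n) = begin
      + 1 * c 0 (suc n) + ∑< (suc n) (λ b → + suc (suc b) * c (suc b) (n ∸ b))
        ≡⟨ cong₂ _+_ (ℤP.*-identityˡ (c 0 (suc n))) (ℤΣ.∑<-cong (suc n) (λ b _ → ℤP.*-distribʳ-+ (c (suc b) (n ∸ b)) (+ 1) (+ suc b))) ⟩
      c 0 (suc n) + ∑< (suc n) (λ b → + 1 * c (suc b) (n ∸ b) + + suc b * c (suc b) (n ∸ b))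
        ≡⟨ cong (λ z → c 0 (suc n) + z) (ℤΣ.∑<-distrib-+ (suc n) (λ b → + 1 * c (suc b) (n ∸ b)) (λ b → + suc b * c (suc b) (n ∸ b))) ⟩
      c 0 (suc n) + (∑< (suc n) (λ b → + 1 * c (suc b) (n ∸ b)) + ∑< (suc n) (λ b → + suc b * c (suc b) (n ∸ b)))
        ≡⟨ sym (ℤP.+-assoc (c 0 (suc n)) _ _) ⟩
      c 0 (suc n) + ∑< (suc n) (λ b → + 1 * c (suc b) (n ∸ b)) + ∑< (suc n) (λ b → + suc b * c (suc b) (n ∸ b))
        ≡⟨ cong₂ _+_ (cong (λ z → c 0 (suc n) + z) (ℤΣ.∑<-cong (suc n) (λ b _ → ℤP.*-identityˡ (c (suc b) (n ∸ b)))))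
                     (trans (ℤΣ.∑<-cong (suc n) (λ b _ → cong (λ i → + suc b * (ρ R ^ i) (n ∸ b)) (ℕP.+-suc j b)))
                            (sym (X*ₛ-suc (weighted (suc j)) n))) ⟩
      geometric j (suc n) + (X *ₛ weighted (suc j)) (suc n)
        ∎
      where
        open ≡-Reasoning
        c : ℕ → Series
        c b = ρ R ^ (j ℕ.+ b)

    weighted≈ : ∀ j → weighted j ≈ₛ ρ R ^ j *ₛ R *ₛ R
    weighted≈ = X-recursion-unique weighted (λ j → ρ R ^ j *ₛ R *ₛ R) (λ j → ρ R ^ j *ₛ R)
      (λ j → 𝕊.trans (weighted-rec j) (+ₛ-congʳ (X *ₛ weighted (suc j)) (geometric≈ j)))
      (λ j → 𝕊.trans (*ₛ-congʳ R (geometric-step j))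
        (solve 4 (λ p x q y → (p :+ x :* (q :* y)) :* y := p :* y :+ x :* (q :* y :* y)) (λ _ → refl) (ρ R ^ j) X (ρ R ^ suc j) R))

    power-coeff : ∀ v m → (ρ R ^ suc v) m ≡ (ρ R ^ v) m + ∑< (pred m) (λ b → (ρ R ^ (v ℕ.+ suc b)) (m ∸ suc (suc b)))
    power-coeff v zero = power-step v 0
    power-coeff v (suc zero) = power-step v 1
    power-coeff v (suc (suc m)) = begin
      (ρ R ^ suc v) (2 ℕ.+ m)
        ≡⟨ power-step v (2 ℕ.+ m) ⟩
      (ρ R ^ v) (2 ℕ.+ m) + (X *ₛ (X *ₛ (ρ R ^ suc v *ₛ R))) (2 ℕ.+ m)
        ≡⟨ cong (λ z → (ρ R ^ v) (2 ℕ.+ m) + z) (trans (X*ₛ-suc (X *ₛ (ρ R ^ suc v *ₛ R)) (suc m)) (X*ₛ-suc (ρ R ^ suc v *ₛ R) m)) ⟩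
      (ρ R ^ v) (2 ℕ.+ m) + (ρ R ^ suc v *ₛ R) m
        ≡⟨ cong (λ z → (ρ R ^ v) (2 ℕ.+ m) + z) (sym (geometric≈ (suc v) m)) ⟩
      (ρ R ^ v) (2 ℕ.+ m) + geometric (suc v) m
        ≡⟨ cong (λ z → (ρ R ^ v) (2 ℕ.+ m) + z) (ℤΣ.∑<-cong (suc m) (λ b _ → cong (λ i → (ρ R ^ i) (m ∸ b)) (sym (ℕP.+-suc v b)))) ⟩
      (ρ R ^ v) (2 ℕ.+ m) + ∑< (suc m) (λ b → (ρ R ^ (v ℕ.+ suc b)) (m ∸ b))
        ∎
      where open ≡-Reasoning

    tails≡coeff : ∀ m v → + tails m v ≡ (ρ R ^ v) m
    tails≡coeff = <-rec (λ m → ∀ v → + tails m v ≡ (ρ R ^ v) m) step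
      where
        δ-coeff : ∀ m → + δ m ≡ ι (+ 1) m
        δ-coeff zero = refl
        δ-coeff (suc m) = refl
        step : ∀ m → (∀ {m'} → m' < m → ∀ v → + tails m' v ≡ (ρ R ^ v) m') → ∀ v → + tails m v ≡ (ρ R ^ v) m
        step m ih zero = trans (cong +_ (tails-zero m)) (δ-coeff m)
        step m ih (suc v) = begin
          + tails m (suc v)
            ≡⟨ cong +_ (tails-suc m v) ⟩
          + (tails m v ℕ.+ ℕΣ.∑< (pred m) (λ b → tails (m ∸ suc (suc b)) (v ℕ.+ suc b)))
            ≡⟨ ℤP.pos-+ (tails m v) _ ⟩
          + tails m v + + ℕΣ.∑< (pred m) (λ b → tails (m ∸ suc (suc b)) (v ℕ.+ suc b))
            ≡⟨ cong₂ _+_ (step m ih v) (trans (pos-∑< (pred m) (λ b → tails (m ∸ suc (suc b)) (v ℕ.+ suc b)))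
                 (ℤΣ.∑<-cong (pred m) (λ b b<m-1 → ih (m∸[2+b]<m m b b<m-1) (v ℕ.+ suc b)))) ⟩
          (ρ R ^ v) m + ∑< (pred m) (λ b → (ρ R ^ (v ℕ.+ suc b)) (m ∸ suc (suc b)))
            ≡⟨ power-coeff v m ⟨
          (ρ R ^ suc v) m
            ∎
          where open ≡-Reasoning

    firstCoeff-R² : ∀ n → firstCoeff (suc (suc n)) ≡ conv R R n
    firstCoeff-R² n = begin
      + sum (map first (stanleyOfSper (suc (suc n))))
        ≡⟨ cong +_ (sum-first-tails n) ⟩
      + ℕΣ.∑< (suc n) (λ e → suc e ℕ.* tails (n ∸ e) e)
        ≡⟨ pos-∑< (suc n) (λ e → suc e ℕ.* tails (n ∸ e) e) ⟩
      ∑< (suc n) (λ e → + (suc e ℕ.* tails (n ∸ e) e))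
        ≡⟨ ℤΣ.∑<-cong (suc n) (λ e _ → trans (ℤP.pos-* (suc e) (tails (n ∸ e) e)) (cong (+ suc e *_) (tails≡coeff (n ∸ e) e))) ⟩
      weighted 0 n
        ≡⟨ weighted≈ 0 n ⟩
      (ι (+ 1) *ₛ R *ₛ R) n
        ≡⟨ *ₛ-congʳ R (conv-identityˡ R) n ⟩
      conv R R n
        ∎
      where open ≡-Reasoning

  qCoeffs DCoeffs numCoeffs : List ℤ
  qCoeffs = + 1 ∷ - + 1 ∷ + 1 ∷ []
  DCoeffs = + 1 ∷ - + 2 ∷ - + 1 ∷ - + 2 ∷ + 1 ∷ []
  numCoeffs = + 1 ∷ - + 2 ∷ + 1 ∷ - + 2 ∷ + 1 ∷ []

  quadratic : Series → Series → Series
  quadratic x r = x *ₛ (x *ₛ (r *ₛ r)) -ₛ horner x qCoeffs *ₛ r +ₛ ι (+ 1)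

  quadraticₑ : ∀ {k} → Polynomial k → Polynomial k → Polynomial k
  quadraticₑ x r = x :* (x :* (r :* r)) :- hornerₑ x qCoeffs :* r :+ con (+ 1)

  square-expansion : ∀ x r → (horner x qCoeffs -ₛ ι (+ 2) *ₛ (x *ₛ (x *ₛ r))) *ₛ (horner x qCoeffs -ₛ ι (+ 2) *ₛ (x *ₛ (x *ₛ r)))
    ≈ₛ horner x DCoeffs +ₛ ι (+ 4) *ₛ (x *ₛ (x *ₛ quadratic x r))
  square-expansion = solve 2 (λ x r → let s = hornerₑ x qCoeffs :- con (+ 2) :* (x :* (x :* r)) in
    s :* s := hornerₑ x DCoeffs :+ con (+ 4) :* (x :* (x :* quadraticₑ x r))) (λ _ → refl)

  R-identity : ∀ x r → r ≈ₛ ι (+ 1) +ₛ x *ₛ ((ι (+ 1) +ₛ x *ₛ (r -ₛ ι (+ 1))) *ₛ r) -ₛ quadratic x r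
  R-identity = solve 2 (λ x r →
    r := con (+ 1) :+ x :* ((con (+ 1) :+ x :* (r :- con (+ 1))) :* r) :- quadraticₑ x r) (λ _ → refl)

  numerator-identity : ∀ x r → horner x numCoeffs -ₛ horner x qCoeffs *ₛ (horner x qCoeffs -ₛ ι (+ 2) *ₛ (x *ₛ (x *ₛ r)))
    ≈ₛ ι (+ 2) *ₛ (x *ₛ (x *ₛ (x *ₛ (x *ₛ (r *ₛ r))))) -ₛ ι (+ 2) *ₛ (x *ₛ (x *ₛ quadratic x r))
  numerator-identity = solve 2 (λ x r →
    hornerₑ x numCoeffs :- hornerₑ x qCoeffs :* (hornerₑ x qCoeffs :- con (+ 2) :* (x :* (x :* r)))
      := con (+ 2) :* (x :* (x :* (x :* (x :* (r :* r))))) :- con (+ 2) :* (x :* (x :* quadraticₑ x r))) (λ _ → refl)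

  module FromSquareRoot (S R : Series) (S²≈D : IsSqrtD S) (R-def : ∀ m → + 2 * R m ≡ (qPoly ⊖s S) (m ℕ.+ 2)) where

    S₁≡-1 : S 1 ≡ - + 1
    S₁≡-1 = ℤP.*-cancelˡ-≡ (+ 2) (S 1) (- + 1) (begin
      + 2 * S 1                      ≡⟨ double (S 1) ⟩
      + 1 * S 1 + (S 1 * + 1 + + 0)  ≡⟨ cong (λ s → s * S 1 + (S 1 * s + + 0)) (sym (proj₂ S²≈D)) ⟩
      conv S S 1                     ≡⟨ proj₁ S²≈D 1 ⟩
      - + 2                          ∎)
      where
        open ≡-Reasoning
        double : ∀ a → + 2 * a ≡ + 1 * a + (a * + 1 + + 0)
        double = solve-∀

    S-expansion : S ≈ₛ qPoly -ₛ ι (+ 2) *ₛ (X *ₛ (X *ₛ R))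
    S-expansion zero = proj₂ S²≈D
    S-expansion (suc zero) = S₁≡-1
    S-expansion (suc (suc m)) = begin
      S (2 ℕ.+ m)                                   ≡⟨ cancel (qPoly (2 ℕ.+ m)) (S (2 ℕ.+ m)) ⟩
      qPoly (2 ℕ.+ m) - (qPoly ⊖s S) (2 ℕ.+ m)      ≡⟨ cong (λ z → qPoly (2 ℕ.+ m) - z) R-def′ ⟨
      qPoly (2 ℕ.+ m) - + 2 * R m                   ≡⟨ cong (λ z → qPoly (2 ℕ.+ m) - z) 2X²R-coeff ⟨
      (qPoly -ₛ ι (+ 2) *ₛ (X *ₛ (X *ₛ R))) (2 ℕ.+ m) ∎
      where
        open ≡-Reasoning
        cancel : ∀ a s → s ≡ a - (a - s)
        cancel = solve-∀
        R-def′ : + 2 * R m ≡ (qPoly ⊖s S) (2 ℕ.+ m)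
        R-def′ = subst (λ k → + 2 * R m ≡ (qPoly ⊖s S) k) (ℕP.+-comm m 2) (R-def m)
        2X²R-coeff : (ι (+ 2) *ₛ (X *ₛ (X *ₛ R))) (2 ℕ.+ m) ≡ + 2 * R m
        2X²R-coeff = trans (conv-ιˡ (+ 2) (X *ₛ (X *ₛ R)) (2 ℕ.+ m)) (cong (+ 2 *_) (trans (X*ₛ-suc (X *ₛ R) (suc m)) (X*ₛ-suc R m)))

    S-horner : S ≈ₛ horner X qCoeffs -ₛ ι (+ 2) *ₛ (X *ₛ (X *ₛ R))
    S-horner = 𝕊.trans S-expansion (-ₛ-cong (poly≈horner qCoeffs) (λ _ → refl))

    quadratic≈0 : quadratic X R ≈ₛ 0ₛ
    quadratic≈0 = X-cancel (quadratic X R) (X-cancel (X *ₛ quadratic X R) (ι-cancel (+ 4) (X *ₛ (X *ₛ quadratic X R)) λ n →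
      +-cancelˡ (horner X DCoeffs n) _ _ (begin
        horner X DCoeffs n + (ι (+ 4) *ₛ (X *ₛ (X *ₛ quadratic X R))) n  ≡⟨ square-expansion X R n ⟨
        (S′ *ₛ S′) n                                                    ≡⟨ conv-cong (𝕊.sym S-horner) (𝕊.sym S-horner) n ⟩
        conv S S n                                                      ≡⟨ proj₁ S²≈D n ⟩
        Dpoly n                                                         ≡⟨ poly≈horner DCoeffs n ⟩
        horner X DCoeffs n                                              ≡⟨ ℤP.+-identityʳ _ ⟨
        horner X DCoeffs n + + 0                                        ∎)))
      where
        open ≡-Reasoning
        S′ = horner X qCoeffs -ₛ ι (+ 2) *ₛ (X *ₛ (X *ₛ R))

    R-eq : R ≈ₛ ι (+ 1) +ₛ X *ₛ (ρ R *ₛ R)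
    R-eq = 𝕊.trans (R-identity X R) (-ₛ-zeroʳ _ quadratic≈0)

    open Tails R R-eq using (firstCoeff-R²)

    firstCoeff≈X²R² : firstCoeff ≈ₛ X *ₛ (X *ₛ (R *ₛ R))
    firstCoeff≈X²R² zero = refl
    firstCoeff≈X²R² (suc zero) = refl
    firstCoeff≈X²R² (suc (suc n)) = trans (firstCoeff-R² n) (sym (trans (X*ₛ-suc (X *ₛ (R *ₛ R)) (suc n)) (X*ₛ-suc (R *ₛ R) n)))

    closedForm : ι (+ 2) *ₛ shift2 firstCoeff ≈ₛ numPoly -ₛ qPoly *ₛ S
    closedForm = begin
      ι (+ 2) *ₛ shift2 firstCoeff
        ≈⟨ *ₛ-congˡ (ι (+ 2)) (𝕊.trans (shift2≈X*X* firstCoeff) (*ₛ-congˡ X (*ₛ-congˡ X firstCoeff≈X²R²))) ⟩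
      ι (+ 2) *ₛ (X *ₛ (X *ₛ (X *ₛ (X *ₛ (R *ₛ R)))))
        ≈⟨ -ₛ-zeroʳ _ (*ₛ-zeroʳ (ι (+ 2)) (*ₛ-zeroʳ X (*ₛ-zeroʳ X quadratic≈0))) ⟨
      ι (+ 2) *ₛ (X *ₛ (X *ₛ (X *ₛ (X *ₛ (R *ₛ R))))) -ₛ ι (+ 2) *ₛ (X *ₛ (X *ₛ quadratic X R))
        ≈⟨ numerator-identity X R ⟨
      horner X numCoeffs -ₛ horner X qCoeffs *ₛ (horner X qCoeffs -ₛ ι (+ 2) *ₛ (X *ₛ (X *ₛ R)))
        ≈⟨ -ₛ-cong (𝕊.sym (poly≈horner numCoeffs)) (conv-cong (𝕊.sym (poly≈horner qCoeffs)) (𝕊.sym S-horner)) ⟩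
      numPoly -ₛ qPoly *ₛ S
        ∎
      where open ≈ₛ-Reasoning

    closedForm-coeff : ∀ m → + 2 * shift2 firstCoeff m ≡ (numPoly ⊖s conv qPoly S) m
    closedForm-coeff m = trans (sym (conv-ιˡ (+ 2) (shift2 firstCoeff) m)) (closedForm m)

    firstCoeff≡R*R : ∀ n → firstCoeff (n ℕ.+ 2) ≡ conv R R n
    firstCoeff≡R*R n = subst (λ k → firstCoeff k ≡ conv R R n) (ℕP.+-comm 2 n) (firstCoeff-R² n)

open import Data.Nat using (_+_)
open import Data.Integer using (+_; _*_)

corollary2p7 : (S R : Series) → IsSqrtD S
    → (∀ m → + 2 * R m ≡ (qPoly ⊖s S) (m + 2))
    → (∀ m → + 2 * shift2 firstCoeff m ≡ (numPoly ⊖s conv qPoly S) m)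
    × (∀ n → firstCoeff (n + 2) ≡ conv R R n)
corollary2p7 S R S²≈D R-def = closedForm-coeff , firstCoeff≡R*R
  where open PowerSeries.FromSquareRoot S R S²≈D R-def
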